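{- Let $G$ be a finite abstract simplicial complex, $A'$ the adjacency matrix of its connection graph $G'$, and $g=(1+A')^{ -1}$. Then $$ \sum_{x,y \in G} g(x,y) = \chi(G). $$
   Context: A finite abstract simplicial complex $G$ is a finite collection of non-empty finite sets (faces) closed under taking non-empty subsets; $\dim(x)=|x|-1$ and $\chi(G)=\sum_{x\in G}(-1)^{\dim(x)}$. The connection graph $G'$ has vertex set $G$, two distinct faces adjacent iff they have non-empty intersection; $A'$ is its adjacency matrix and $1$ the identity matrix. The matrix $1+A'$ is known to be invertible. -}

module Defs where

open import Data.Nat using (ℕ; zero; suc)
open import Data.Fin using (Fin; zero; suc; _≟_)
open import Data.Fin.Subset using (Subset; _⊆_; _∩_; Nonempty; ∣_∣)
open import Data.Fin.Subset.Properties using (nonempty?)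
open import Data.List using (List; length; lookup)
open import Data.List.Membership.Propositional using (_∈_)
open import Data.List.Relation.Unary.All using (All)
open import Data.List.Relation.Unary.Unique.Propositional using (Unique)
open import Data.Rational using (ℚ; 0ℚ; 1ℚ; _+_; _*_; -_)
open import Relation.Nullary using (yes; no)

record SimplicialComplex (n : ℕ) : Set where
  field
    faces    : List (Subset n)
    distinct : Unique faces
    nonempty : All Nonempty faces
    closed   : ∀ {x y} → x ∈ faces → y ⊆ x → Nonempty y → y ∈ faces

open SimplicialComplex public

size : ∀ {n} → SimplicialComplex n → ℕ
size G = length (faces G)

face : ∀ {n} (G : SimplicialComplex n) → Fin (size G) → Subset n
face G i = lookup (faces G) i

Σℚ : ∀ {m} → (Fin m → ℚ) → ℚ
Σℚ {zero}  f = 0ℚ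
Σℚ {suc m} f = f zero + Σℚ (λ i → f (suc i))

Matrix : ℕ → Set
Matrix m = Fin m → Fin m → ℚ

identity : ∀ {m} → Matrix m
identity i j with i ≟ j
... | yes _ = 1ℚ
... | no  _ = 0ℚ

_+ᴹ_ : ∀ {m} → Matrix m → Matrix m → Matrix m
(M +ᴹ N) i j = M i j + N i j

_*ᴹ_ : ∀ {m} → Matrix m → Matrix m → Matrix m
(M *ᴹ N) i k = Σℚ (λ j → M i j * N j k)

connAdj : ∀ {n} (G : SimplicialComplex n) → Matrix (size G)
connAdj G i j with i ≟ j
... | yes _ = 0ℚ
... | no  _ with nonempty? (face G i ∩ face G j)
...   | yes _ = 1ℚ
...   | no  _ = 0ℚ

sign : ℕ → ℚ
sign zero    = 1ℚ
sign (suc k) = - sign k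

-- dim x = |x| - 1, so (-1)^dim(x) = - (-1)^|x|
χ : ∀ {n} → SimplicialComplex n → ℚ
χ G = Σℚ (λ i → - sign ∣ face G i ∣)

IsInverse : ∀ {m} → Matrix m → Matrix m → Set
IsInverse M g = (∀ i j → (M *ᴹ g) i j ≡ identity i j)
              × (∀ i j → (g *ᴹ M) i j ≡ identity i j)
  where open import Relation.Binary.PropositionalEquality using (_≡_)
        open import Data.Product using (_×_)

-- Write ω(x) = (-1)^dim x and v(x) = ω(x) Σ_{z ⊇ x} ω(z); these are the row sums of g
-- predicted by the Green star formula g(x,y) = ω(x) ω(y) χ(St(x) ∩ St(y)). The only
-- combinatorial input is that a simplex has Euler characteristic one:
-- Σ_{∅ ≠ y ⊆ S} ω(y) = 1 for S ≠ ∅. Applied to a face z and to z ∖ x it shows that the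
-- faces y ⊆ z meeting x contribute [z ⊆ x] in total, hence (1 + A') v = 1 and g 1 = v.
-- Summing, Σ_{x,y} g(x,y) = Σ_x v(x) = Σ_z ω(z) Σ_{x ⊆ z} ω(x) = Σ_z ω(z) = χ(G).
module Submission where

open import Algebra.Bundles using (CommutativeMonoid)
open import Data.Bool using (Bool; true; false; _∧_; not)
open import Data.Bool.Properties using (∧-identityʳ; ∧-zeroʳ) renaming (_≟_ to _≟ᵇ_)
open import Data.Empty using (⊥-elim)
open import Data.Fin using (Fin; zero; suc; _≟_)
open import Data.Fin.Properties using (suc-injective)
open import Data.Fin.Subset using (Subset; _⊆_; _∩_; _─_; ⊥; Nonempty; ∣_∣; inside; outside)
open import Data.Fin.Subset.Properties using (_⊆?_; nonempty?; ∉⊥; Empty-unique; ∩-idem; p─q⊆p)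
open import Data.List using (List; []; _∷_; lookup)
open import Data.List.Membership.Propositional using (_∈_; _∉_)
open import Data.List.Membership.Propositional.Properties using (∈-lookup)
open import Data.List.Relation.Unary.All as All using ()
open import Data.List.Relation.Unary.AllPairs using (_∷_)
open import Data.List.Relation.Unary.Any using (here; there)
open import Data.List.Relation.Unary.Unique.Propositional using (Unique)
open import Data.Nat using (ℕ; zero; suc)
open import Data.Product using (_,_)
open import Data.Rational using (ℚ; 0ℚ; 1ℚ; _+_; _*_; -_)
open import Data.Rational.Properties
  using ( +-identityˡ; +-identityʳ; +-inverseʳ; +-comm; *-assoc
        ; *-identityˡ; *-identityʳ; *-zeroˡ; *-zeroʳ; *-distribˡ-+; *-distribʳ-+
        ; neg-distrib-+; neg-distribʳ-*; +-0-group; +-0-commutativeMonoid)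
open import Data.Rational.Solver using (module +-*-Solver)
open import Data.Vec using ([]; _∷_)
open import Data.Vec.Properties using (≡-dec)
open import Function using (_∘_)
open import Relation.Binary.Definitions using (DecidableEquality)
open import Relation.Binary.PropositionalEquality
open import Relation.Nullary using (Dec; _because_; yes; no; does; ¬?; _×-dec_)

open import Algebra.Properties.CommutativeSemigroup
  (CommutativeMonoid.commutativeSemigroup +-0-commutativeMonoid) using (interchange)
open import Algebra.Properties.Group +-0-group using (∙-cancelʳ; ⁻¹-involutive)
open +-*-Solver using (solve; _:=_; _:*_)

open import Defs

Σℚ-cong : ∀ {m} {f g : Fin m → ℚ} → (∀ i → f i ≡ g i) → Σℚ f ≡ Σℚ g
Σℚ-cong {zero}  f≗g = refl
Σℚ-cong {suc m} f≗g = cong₂ _+_ (f≗g zero) (Σℚ-cong (f≗g ∘ suc))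

Σℚ-0 : ∀ m → Σℚ {m} (λ _ → 0ℚ) ≡ 0ℚ
Σℚ-0 zero    = refl
Σℚ-0 (suc m) = trans (+-identityˡ _) (Σℚ-0 m)

Σℚ-+ : ∀ {m} (f g : Fin m → ℚ) → Σℚ (λ i → f i + g i) ≡ Σℚ f + Σℚ g
Σℚ-+ {zero}  f g = refl
Σℚ-+ {suc m} f g = trans (cong (f zero + g zero +_) (Σℚ-+ (f ∘ suc) (g ∘ suc)))
                         (interchange (f zero) (g zero) (Σℚ (f ∘ suc)) (Σℚ (g ∘ suc)))

Σℚ-*ˡ : ∀ {m} c (f : Fin m → ℚ) → Σℚ (λ i → c * f i) ≡ c * Σℚ f
Σℚ-*ˡ {zero}  c f = sym (*-zeroʳ c)
Σℚ-*ˡ {suc m} c f = trans (cong (c * f zero +_) (Σℚ-*ˡ c (f ∘ suc)))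
                          (sym (*-distribˡ-+ c (f zero) (Σℚ (f ∘ suc))))

Σℚ-*ʳ : ∀ {m} c (f : Fin m → ℚ) → Σℚ (λ i → f i * c) ≡ Σℚ f * c
Σℚ-*ʳ {zero}  c f = sym (*-zeroˡ c)
Σℚ-*ʳ {suc m} c f = trans (cong (f zero * c +_) (Σℚ-*ʳ c (f ∘ suc)))
                          (sym (*-distribʳ-+ c (f zero) (Σℚ (f ∘ suc))))

Σℚ-comm : ∀ {m k} (f : Fin m → Fin k → ℚ) →
          Σℚ (λ i → Σℚ (λ j → f i j)) ≡ Σℚ (λ j → Σℚ (λ i → f i j))
Σℚ-comm {zero}  {k} f = sym (Σℚ-0 k)
Σℚ-comm {suc m}     f = trans (cong (Σℚ (f zero) +_) (Σℚ-comm (f ∘ suc)))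
                              (sym (Σℚ-+ (f zero) (λ j → Σℚ (λ i → f (suc i) j))))

Σℚ-*-Σℚ : ∀ {m k} (a : Fin m → ℚ) (b : Fin m → Fin k → ℚ) →
          Σℚ (λ i → a i * Σℚ (b i)) ≡ Σℚ (λ j → Σℚ (λ i → a i * b i j))
Σℚ-*-Σℚ a b = trans (Σℚ-cong (λ i → sym (Σℚ-*ˡ (a i) (b i)))) (Σℚ-comm (λ i j → a i * b i j))

Σℚ-single : ∀ {m} {f : Fin m → ℚ} x → (∀ k → k ≢ x → f k ≡ 0ℚ) → Σℚ f ≡ f x
Σℚ-single {suc m} {f} zero vanish =
  trans (cong (f zero +_) (trans (Σℚ-cong (λ k → vanish (suc k) λ ())) (Σℚ-0 m)))
        (+-identityʳ (f zero))
Σℚ-single {suc m} {f} (suc x) vanish =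
  trans (cong (_+ Σℚ (f ∘ suc)) (vanish zero λ ()))
        (trans (+-identityˡ _) (Σℚ-single x (λ k k≢x → vanish (suc k) (k≢x ∘ suc-injective))))

identity-refl : ∀ {m} (i : Fin m) → identity i i ≡ 1ℚ
identity-refl i with i ≟ i
... | yes _   = refl
... | no  i≢i = ⊥-elim (i≢i refl)

identity-≢ : ∀ {m} {i j : Fin m} → i ≢ j → identity i j ≡ 0ℚ
identity-≢ {i = i} {j} i≢j with i ≟ j
... | yes i≡j = ⊥-elim (i≢j i≡j)
... | no  _   = refl

infixl 7 _·_

_·_ : ∀ {m} → Matrix m → (Fin m → ℚ) → Fin m → ℚ
(M · u) i = Σℚ (λ j → M i j * u j)

identity-· : ∀ {m} (u : Fin m → ℚ) i → (identity · u) i ≡ u i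
identity-· u i = begin
  (identity · u) i       ≡⟨ Σℚ-single i (λ k k≢i → trans (cong (_* u k) (identity-≢ (k≢i ∘ sym))) (*-zeroˡ (u k))) ⟩
  identity i i * u i     ≡⟨ cong (_* u i) (identity-refl i) ⟩
  1ℚ * u i               ≡⟨ *-identityˡ (u i) ⟩
  u i                    ∎
  where open ≡-Reasoning

*ᴹ-·-assoc : ∀ {m} (A B : Matrix m) u i → ((A *ᴹ B) · u) i ≡ (A · (B · u)) i
*ᴹ-·-assoc A B u i = begin
  Σℚ (λ k → Σℚ (λ j → A i j * B j k) * u k)   ≡⟨ Σℚ-cong (λ k → sym (Σℚ-*ʳ (u k) (λ j → A i j * B j k))) ⟩
  Σℚ (λ k → Σℚ (λ j → A i j * B j k * u k))   ≡⟨ Σℚ-comm (λ k j → A i j * B j k * u k) ⟩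
  Σℚ (λ j → Σℚ (λ k → A i j * B j k * u k))   ≡⟨ Σℚ-cong (λ j → Σℚ-cong (λ k → *-assoc (A i j) (B j k) (u k))) ⟩
  Σℚ (λ j → Σℚ (λ k → A i j * (B j k * u k))) ≡⟨ Σℚ-cong (λ j → Σℚ-*ˡ (A i j) (λ k → B j k * u k)) ⟩
  (A · (B · u)) i                             ∎
  where open ≡-Reasoning

row-sum-of-left-inverse : ∀ {m} (M g : Matrix m) (u : Fin m → ℚ) →
                          (∀ i j → (g *ᴹ M) i j ≡ identity i j) →
                          (∀ i → (M · u) i ≡ 1ℚ) →
                          ∀ i → Σℚ (g i) ≡ u i
row-sum-of-left-inverse M g u gM≡1 Mu≡1 i = begin
  Σℚ (g i)                 ≡⟨ Σℚ-cong (λ j → trans (sym (*-identityʳ (g i j))) (cong (g i j *_) (sym (Mu≡1 j)))) ⟩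
  (g · (M · u)) i          ≡⟨ sym (*ᴹ-·-assoc g M u i) ⟩
  ((g *ᴹ M) · u) i         ≡⟨ Σℚ-cong (λ j → cong (_* u j) (gM≡1 i j)) ⟩
  (identity · u) i         ≡⟨ identity-· u i ⟩
  u i                      ∎
  where open ≡-Reasoning

𝟙 : Bool → ℚ
𝟙 true  = 1ℚ
𝟙 false = 0ℚ

⟦_⟧ : ∀ {a} {A : Set a} → Dec A → ℚ
⟦ a? ⟧ = 𝟙 (does a?)

⟦⟧+⟦¬?⟧≡1 : ∀ {a} {A : Set a} (a? : Dec A) → ⟦ a? ⟧ + ⟦ ¬? a? ⟧ ≡ 1ℚ
⟦⟧+⟦¬?⟧≡1 (true  because _) = refl
⟦⟧+⟦¬?⟧≡1 (false because _) = refl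

_≟ₛ_ : ∀ {n} → DecidableEquality (Subset n)
_≟ₛ_ = ≡-dec _≟ᵇ_

-- Unlike nonempty?, this decision computes structurally on the vector p.
empty? : ∀ {n} (p : Subset n) → Dec (p ≡ ⊥)
empty? p = p ≟ₛ ⊥

intersects? : ∀ {n} (p q : Subset n) → Dec (p ∩ q ≢ ⊥)
intersects? p q = ¬? (empty? (p ∩ q))

nonempty⇒≢⊥ : ∀ {n} {p : Subset n} → Nonempty p → p ≢ ⊥
nonempty⇒≢⊥ (_ , x∈p) refl = ∉⊥ x∈p

≢⊥⇒nonempty : ∀ {n} {p : Subset n} → p ≢ ⊥ → Nonempty p
≢⊥⇒nonempty {p = p} p≢⊥ with nonempty? p
... | yes p≠∅ = p≠∅
... | no  p=∅ = ⊥-elim (p≢⊥ (Empty-unique p=∅))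

does-nonempty? : ∀ {n} (p : Subset n) → does (nonempty? p) ≡ not (does (empty? p))
does-nonempty? p with nonempty? p | empty? p
... | yes p≠∅ | yes p≡⊥ = ⊥-elim (nonempty⇒≢⊥ p≠∅ p≡⊥)
... | yes _   | no  _   = refl
... | no  _   | yes _   = refl
... | no  p=∅ | no  p≢⊥ = ⊥-elim (p=∅ (≢⊥⇒nonempty p≢⊥))

empty?-─ : ∀ {n} (p r : Subset n) → does (empty? (p ─ r)) ≡ does (p ⊆? r)
empty?-─ []            []            = refl
empty?-─ (outside ∷ p) (outside ∷ r) = empty?-─ p r
empty?-─ (outside ∷ p) (inside  ∷ r) = empty?-─ p r
empty?-─ (inside  ∷ p) (outside ∷ r) = refl
empty?-─ (inside  ∷ p) (inside  ∷ r) = empty?-─ p r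

⊆?-─ : ∀ {n} (q p r : Subset n) → does (q ⊆? p ─ r) ≡ does (q ⊆? p) ∧ does (empty? (r ∩ q))
⊆?-─ []            []            []            = refl
⊆?-─ (outside ∷ q) (_       ∷ p) (outside ∷ r) = ⊆?-─ q p r
⊆?-─ (outside ∷ q) (_       ∷ p) (inside  ∷ r) = ⊆?-─ q p r
⊆?-─ (inside  ∷ q) (outside ∷ p) (outside ∷ r) = refl
⊆?-─ (inside  ∷ q) (outside ∷ p) (inside  ∷ r) = refl
⊆?-─ (inside  ∷ q) (inside  ∷ p) (outside ∷ r) = ⊆?-─ q p r
⊆?-─ (inside  ∷ q) (inside  ∷ p) (inside  ∷ r) = sym (∧-zeroʳ (does (q ⊆? p)))

-- Sums over all subsets of Fin n

ΣSubset : ∀ {n} → (Subset n → ℚ) → ℚ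
ΣSubset {zero}  f = f []
ΣSubset {suc n} f = ΣSubset (λ T → f (outside ∷ T)) + ΣSubset (λ T → f (inside ∷ T))

ΣSubset-cong : ∀ {n} {f g : Subset n → ℚ} → (∀ T → f T ≡ g T) → ΣSubset f ≡ ΣSubset g
ΣSubset-cong {zero}  f≗g = f≗g []
ΣSubset-cong {suc n} f≗g = cong₂ _+_ (ΣSubset-cong (f≗g ∘ (outside ∷_))) (ΣSubset-cong (f≗g ∘ (inside ∷_)))

ΣSubset-zeroˡ : ∀ {n} (f : Subset n → ℚ) → ΣSubset (λ T → 0ℚ * f T) ≡ 0ℚ
ΣSubset-zeroˡ {zero}  f = *-zeroˡ (f [])
ΣSubset-zeroˡ {suc n} f = trans (cong₂ _+_ (ΣSubset-zeroˡ (f ∘ (outside ∷_))) (ΣSubset-zeroˡ (f ∘ (inside ∷_))))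
                                (+-identityˡ 0ℚ)

ΣSubset-+ : ∀ {n} (f g : Subset n → ℚ) → ΣSubset (λ T → f T + g T) ≡ ΣSubset f + ΣSubset g
ΣSubset-+ {zero}  f g = refl
ΣSubset-+ {suc n} f g =
  trans (cong₂ _+_ (ΣSubset-+ (f ∘ (outside ∷_)) (g ∘ (outside ∷_))) (ΣSubset-+ (f ∘ (inside ∷_)) (g ∘ (inside ∷_))))
        (interchange (ΣSubset (f ∘ (outside ∷_))) (ΣSubset (g ∘ (outside ∷_)))
                     (ΣSubset (f ∘ (inside ∷_))) (ΣSubset (g ∘ (inside ∷_))))

ΣSubset-neg : ∀ {n} (f : Subset n → ℚ) → ΣSubset (λ T → - f T) ≡ - ΣSubset f
ΣSubset-neg {zero}  f = refl
ΣSubset-neg {suc n} f =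
  trans (cong₂ _+_ (ΣSubset-neg (f ∘ (outside ∷_))) (ΣSubset-neg (f ∘ (inside ∷_))))
        (sym (neg-distrib-+ (ΣSubset (f ∘ (outside ∷_))) (ΣSubset (f ∘ (inside ∷_)))))

ΣSubset-point : ∀ {n} (a : Subset n) (h : Subset n → ℚ) → ΣSubset (λ T → ⟦ a ≟ₛ T ⟧ * h T) ≡ h a
ΣSubset-point []            h = *-identityˡ (h [])
ΣSubset-point (outside ∷ a) h =
  trans (cong₂ _+_ (ΣSubset-point a (h ∘ (outside ∷_))) (ΣSubset-zeroˡ (h ∘ (inside ∷_)))) (+-identityʳ _)
ΣSubset-point (inside  ∷ a) h =
  trans (cong₂ _+_ (ΣSubset-zeroˡ (h ∘ (outside ∷_))) (ΣSubset-point a (h ∘ (inside ∷_)))) (+-identityˡ _)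

Σ⊆-sign : ∀ {n} (S : Subset n) → ΣSubset (λ T → ⟦ T ⊆? S ⟧ * sign ∣ T ∣) ≡ ⟦ empty? S ⟧
Σ⊆-sign []            = *-identityˡ 1ℚ
Σ⊆-sign {suc n} (outside ∷ S) =
  trans (cong₂ _+_ (Σ⊆-sign S) (ΣSubset-zeroˡ {n} (λ T → sign ∣ inside ∷ T ∣))) (+-identityʳ _)
Σ⊆-sign (inside  ∷ S) = begin
  Σ₊ + ΣSubset (λ T → ⟦ T ⊆? S ⟧ * - sign ∣ T ∣)
    ≡⟨ cong (Σ₊ +_) (ΣSubset-cong (λ T → sym (neg-distribʳ-* ⟦ T ⊆? S ⟧ (sign ∣ T ∣)))) ⟩
  Σ₊ + ΣSubset (λ T → - (⟦ T ⊆? S ⟧ * sign ∣ T ∣))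
    ≡⟨ cong (Σ₊ +_) (ΣSubset-neg (λ T → ⟦ T ⊆? S ⟧ * sign ∣ T ∣)) ⟩
  Σ₊ + - Σ₊
    ≡⟨ +-inverseʳ Σ₊ ⟩
  0ℚ ∎
  where
  open ≡-Reasoning
  Σ₊ = ΣSubset (λ T → ⟦ T ⊆? S ⟧ * sign ∣ T ∣)

𝟙-split : ∀ a b → 𝟙 (not b) * 𝟙 a + 𝟙 (a ∧ b) ≡ 𝟙 a
𝟙-split false false = refl
𝟙-split false true  = refl
𝟙-split true  false = refl
𝟙-split true  true  = refl

ω : ∀ {n} → Subset n → ℚ
ω x = - sign ∣ x ∣

χ-simplex : ∀ {n} (S : Subset n) →
            ΣSubset (λ T → ⟦ T ⊆? S ×-dec ¬? (empty? T) ⟧ * ω T) ≡ ⟦ ¬? (empty? S) ⟧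
χ-simplex []            = *-zeroˡ (ω [])
χ-simplex {suc n} (outside ∷ S) =
  trans (cong₂ _+_ (χ-simplex S) (ΣSubset-zeroˡ {n} (ω ∘ (inside ∷_)))) (+-identityʳ _)
χ-simplex (inside  ∷ S) = begin
  ΣSubset (λ T → ⟦ T ⊆? S ×-dec ¬? (empty? T) ⟧ * ω T)
    + ΣSubset (λ T → 𝟙 (does (T ⊆? S) ∧ true) * - - sign ∣ T ∣)
    ≡⟨ cong₂ _+_ (χ-simplex S)
                 (ΣSubset-cong (λ T → cong₂ _*_ (cong 𝟙 (∧-identityʳ (does (T ⊆? S)))) (⁻¹-involutive (sign ∣ T ∣)))) ⟩
  ⟦ ¬? (empty? S) ⟧ + ΣSubset (λ T → ⟦ T ⊆? S ⟧ * sign ∣ T ∣)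
    ≡⟨ cong (⟦ ¬? (empty? S) ⟧ +_) (Σ⊆-sign S) ⟩
  ⟦ ¬? (empty? S) ⟧ + ⟦ empty? S ⟧
    ≡⟨ +-comm ⟦ ¬? (empty? S) ⟧ ⟦ empty? S ⟧ ⟩
  ⟦ empty? S ⟧ + ⟦ ¬? (empty? S) ⟧
    ≡⟨ ⟦⟧+⟦¬?⟧≡1 (empty? S) ⟩
  1ℚ ∎
  where open ≡-Reasoning

-- Sums over the faces of a complex

multiplicity : ∀ {m n} → (Fin m → Subset n) → Subset n → ℚ
multiplicity X T = Σℚ (λ i → ⟦ X i ≟ₛ T ⟧)

Σℚ-by-multiplicity : ∀ {m n} (X : Fin m → Subset n) (h : Subset n → ℚ) →
                     Σℚ (λ i → h (X i)) ≡ ΣSubset (λ T → multiplicity X T * h T)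
Σℚ-by-multiplicity {zero}  X h = sym (ΣSubset-zeroˡ h)
Σℚ-by-multiplicity {suc m} X h = begin
  h (X zero) + Σℚ (λ i → h (X (suc i)))
    ≡⟨ cong₂ _+_ (sym (ΣSubset-point (X zero) h)) (Σℚ-by-multiplicity (X ∘ suc) h) ⟩
  ΣSubset (λ T → ⟦ X zero ≟ₛ T ⟧ * h T) + ΣSubset (λ T → multiplicity (X ∘ suc) T * h T)
    ≡⟨ sym (ΣSubset-+ (λ T → ⟦ X zero ≟ₛ T ⟧ * h T) (λ T → multiplicity (X ∘ suc) T * h T)) ⟩
  ΣSubset (λ T → ⟦ X zero ≟ₛ T ⟧ * h T + multiplicity (X ∘ suc) T * h T)
    ≡⟨ ΣSubset-cong (λ T → sym (*-distribʳ-+ (h T) ⟦ X zero ≟ₛ T ⟧ (multiplicity (X ∘ suc) T))) ⟩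
  ΣSubset (λ T → multiplicity X T * h T) ∎
  where open ≡-Reasoning

multiplicity-∉ : ∀ {n} (L : List (Subset n)) {T} → T ∉ L → multiplicity (lookup L) T ≡ 0ℚ
multiplicity-∉ []      T∉L = refl
multiplicity-∉ (a ∷ L) {T} T∉L with a ≟ₛ T
... | yes refl = ⊥-elim (T∉L (here refl))
... | no  _    = trans (+-identityˡ _) (multiplicity-∉ L (T∉L ∘ there))

multiplicity-∈ : ∀ {n} {L : List (Subset n)} {T} → Unique L → T ∈ L → multiplicity (lookup L) T ≡ 1ℚ
multiplicity-∈ {L = a ∷ L} {T} (a∉L ∷ unique) T∈L with a ≟ₛ T | T∈L
... | yes refl | _         = trans (cong (1ℚ +_) (multiplicity-∉ L (λ a∈L → All.lookup a∉L a∈L refl)))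
                                   (+-identityʳ 1ℚ)
... | no  a≢T  | here T≡a  = ⊥-elim (a≢T (sym T≡a))
... | no  _    | there T∈L′ = trans (+-identityˡ _) (multiplicity-∈ unique T∈L′)

module _ {n} (G : SimplicialComplex n) where

  private
    X : Fin (size G) → Subset n
    X = face G

  face-nonempty : ∀ i → does (empty? (X i)) ≡ false
  face-nonempty i with empty? (X i)
  ... | yes Xi≡⊥ = ⊥-elim (nonempty⇒≢⊥ (All.lookup (nonempty G) (∈-lookup i)) Xi≡⊥)
  ... | no  _    = refl

  χ-faces-⊆ : (S : Subset n) → (∀ {T} → T ⊆ S → Nonempty T → T ∈ faces G) →
              Σℚ (λ y → ⟦ X y ⊆? S ⟧ * ω (X y)) ≡ ⟦ ¬? (empty? S) ⟧
  χ-faces-⊆ S closed-S = begin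
    Σℚ (λ y → ⟦ X y ⊆? S ⟧ * ω (X y))
      ≡⟨ Σℚ-by-multiplicity X (λ T → ⟦ T ⊆? S ⟧ * ω T) ⟩
    ΣSubset (λ T → multiplicity X T * (⟦ T ⊆? S ⟧ * ω T))
      ≡⟨ ΣSubset-cong counted-once ⟩
    ΣSubset (λ T → ⟦ T ⊆? S ×-dec ¬? (empty? T) ⟧ * ω T)
      ≡⟨ χ-simplex S ⟩
    ⟦ ¬? (empty? S) ⟧ ∎
    where
    open ≡-Reasoning
    counted-once : ∀ T → multiplicity X T * (⟦ T ⊆? S ⟧ * ω T) ≡ ⟦ T ⊆? S ×-dec ¬? (empty? T) ⟧ * ω T
    counted-once T with T ⊆? S | empty? T
    ... | no  _   | _       = trans (cong (multiplicity X T *_) (*-zeroˡ (ω T)))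
                                    (trans (*-zeroʳ (multiplicity X T)) (sym (*-zeroˡ (ω T))))
    ... | yes _   | yes T≡⊥ = trans (cong (_* (1ℚ * ω T)) (multiplicity-∉ (faces G) T∉G))
                                    (trans (*-zeroˡ (1ℚ * ω T)) (sym (*-zeroˡ (ω T))))
      where
      T∉G : T ∉ faces G
      T∉G T∈G = nonempty⇒≢⊥ (All.lookup (nonempty G) T∈G) T≡⊥
    ... | yes T⊆S | no  T≢⊥ = trans (cong (_* (1ℚ * ω T)) (multiplicity-∈ (distinct G) (closed-S T⊆S (≢⊥⇒nonempty T≢⊥))))
                                    (*-identityˡ _)

  χ-face : ∀ z → Σℚ (λ y → ⟦ X y ⊆? X z ⟧ * ω (X y)) ≡ 1ℚ
  χ-face z = trans (χ-faces-⊆ (X z) (closed G (∈-lookup z))) (cong (𝟙 ∘ not) (face-nonempty z))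

  connAdj-refl : ∀ i → connAdj G i i ≡ 0ℚ
  connAdj-refl i with i ≟ i
  ... | yes _   = refl
  ... | no  i≢i = ⊥-elim (i≢i refl)

  connAdj-≢ : ∀ {i j} → i ≢ j → connAdj G i j ≡ ⟦ nonempty? (X i ∩ X j) ⟧
  connAdj-≢ {i} {j} i≢j with i ≟ j
  ... | yes i≡j = ⊥-elim (i≢j i≡j)
  ... | no  _ with nonempty? (X i ∩ X j)
  ...   | yes _ = refl
  ...   | no  _ = refl

  connection-matrix : ∀ i j → (identity +ᴹ connAdj G) i j ≡ ⟦ intersects? (X i) (X j) ⟧
  connection-matrix i j = entry i j (i ≟ j)
    where
    open ≡-Reasoning
    entry : ∀ i j → Dec (i ≡ j) → (identity +ᴹ connAdj G) i j ≡ ⟦ intersects? (X i) (X j) ⟧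
    entry i .i (yes refl) = begin
      identity i i + connAdj G i i   ≡⟨ cong₂ _+_ (identity-refl i) (connAdj-refl i) ⟩
      1ℚ + 0ℚ                        ≡⟨ +-identityʳ 1ℚ ⟩
      1ℚ                             ≡⟨ cong (𝟙 ∘ not) (trans (cong (does ∘ empty?) (∩-idem (X i))) (face-nonempty i)) ⟨
      ⟦ intersects? (X i) (X i) ⟧    ∎
    entry i j (no i≢j) = begin
      identity i j + connAdj G i j   ≡⟨ cong₂ _+_ (identity-≢ i≢j) (connAdj-≢ i≢j) ⟩
      0ℚ + ⟦ nonempty? (X i ∩ X j) ⟧ ≡⟨ +-identityˡ _ ⟩
      ⟦ nonempty? (X i ∩ X j) ⟧      ≡⟨ cong 𝟙 (does-nonempty? (X i ∩ X j)) ⟩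
      ⟦ intersects? (X i) (X j) ⟧    ∎

  Σ-intersecting-⊆ : ∀ p z → Σℚ (λ y → ⟦ intersects? p (X y) ⟧ * ⟦ X y ⊆? X z ⟧ * ω (X y)) ≡ ⟦ X z ⊆? p ⟧
  Σ-intersecting-⊆ p z = ∙-cancelʳ ⟦ ¬? (X z ⊆? p) ⟧ Σ∩ ⟦ X z ⊆? p ⟧ (begin
    Σ∩ + ⟦ ¬? (X z ⊆? p) ⟧
      ≡⟨ cong (λ b → Σ∩ + 𝟙 (not b)) (empty?-─ (X z) p) ⟨
    Σ∩ + ⟦ ¬? (empty? (X z ─ p)) ⟧
      ≡⟨ cong (Σ∩ +_) (χ-faces-⊆ (X z ─ p) (λ T⊆z─p → closed G (∈-lookup z) (p─q⊆p (X z) p ∘ T⊆z─p))) ⟨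
    Σ∩ + Σℚ (λ y → ⟦ X y ⊆? X z ─ p ⟧ * ω (X y))
      ≡⟨ Σℚ-+ (λ y → ⟦ intersects? p (X y) ⟧ * ⟦ X y ⊆? X z ⟧ * ω (X y)) (λ y → ⟦ X y ⊆? X z ─ p ⟧ * ω (X y)) ⟨
    Σℚ (λ y → ⟦ intersects? p (X y) ⟧ * ⟦ X y ⊆? X z ⟧ * ω (X y) + ⟦ X y ⊆? X z ─ p ⟧ * ω (X y))
      ≡⟨ Σℚ-cong split ⟩
    Σℚ (λ y → ⟦ X y ⊆? X z ⟧ * ω (X y))
      ≡⟨ χ-face z ⟩
    1ℚ
      ≡⟨ ⟦⟧+⟦¬?⟧≡1 (X z ⊆? p) ⟨
    ⟦ X z ⊆? p ⟧ + ⟦ ¬? (X z ⊆? p) ⟧ ∎)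
    where
    open ≡-Reasoning
    Σ∩ : ℚ
    Σ∩ = Σℚ (λ y → ⟦ intersects? p (X y) ⟧ * ⟦ X y ⊆? X z ⟧ * ω (X y))
    split : ∀ y → ⟦ intersects? p (X y) ⟧ * ⟦ X y ⊆? X z ⟧ * ω (X y) + ⟦ X y ⊆? X z ─ p ⟧ * ω (X y)
                ≡ ⟦ X y ⊆? X z ⟧ * ω (X y)
    split y = begin
      ⟦ intersects? p (X y) ⟧ * ⟦ X y ⊆? X z ⟧ * ω (X y) + ⟦ X y ⊆? X z ─ p ⟧ * ω (X y)
        ≡⟨ *-distribʳ-+ (ω (X y)) (⟦ intersects? p (X y) ⟧ * ⟦ X y ⊆? X z ⟧) ⟦ X y ⊆? X z ─ p ⟧ ⟨
      (⟦ intersects? p (X y) ⟧ * ⟦ X y ⊆? X z ⟧ + ⟦ X y ⊆? X z ─ p ⟧) * ω (X y)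
        ≡⟨ cong (λ b → (⟦ intersects? p (X y) ⟧ * ⟦ X y ⊆? X z ⟧ + 𝟙 b) * ω (X y)) (⊆?-─ (X y) (X z) p) ⟩
      (⟦ intersects? p (X y) ⟧ * ⟦ X y ⊆? X z ⟧ + 𝟙 (does (X y ⊆? X z) ∧ does (empty? (p ∩ X y)))) * ω (X y)
        ≡⟨ cong (_* ω (X y)) (𝟙-split (does (X y ⊆? X z)) (does (empty? (p ∩ X y)))) ⟩
      ⟦ X y ⊆? X z ⟧ * ω (X y) ∎

  signedStar : Fin (size G) → ℚ
  signedStar x = ω (X x) * Σℚ (λ z → ⟦ X x ⊆? X z ⟧ * ω (X z))

  connection-·-signedStar : ∀ x → ((identity +ᴹ connAdj G) · signedStar) x ≡ 1ℚ
  connection-·-signedStar x = begin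
    Σℚ (λ y → (identity +ᴹ connAdj G) x y * signedStar y)
      ≡⟨ Σℚ-cong (λ y → trans (cong (_* signedStar y) (connection-matrix x y))
                              (sym (*-assoc (c y) (ω (X y)) _))) ⟩
    Σℚ (λ y → c y * ω (X y) * Σℚ (λ z → ⟦ X y ⊆? X z ⟧ * ω (X z)))
      ≡⟨ Σℚ-*-Σℚ (λ y → c y * ω (X y)) (λ y z → ⟦ X y ⊆? X z ⟧ * ω (X z)) ⟩
    Σℚ (λ z → Σℚ (λ y → c y * ω (X y) * (⟦ X y ⊆? X z ⟧ * ω (X z))))
      ≡⟨ Σℚ-cong (λ z → trans (Σℚ-cong (λ y → rearrange (c y) (ω (X y)) ⟦ X y ⊆? X z ⟧ (ω (X z))))
                              (Σℚ-*ʳ (ω (X z)) (λ y → c y * ⟦ X y ⊆? X z ⟧ * ω (X y)))) ⟩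
    Σℚ (λ z → Σℚ (λ y → c y * ⟦ X y ⊆? X z ⟧ * ω (X y)) * ω (X z))
      ≡⟨ Σℚ-cong (λ z → cong (_* ω (X z)) (Σ-intersecting-⊆ (X x) z)) ⟩
    Σℚ (λ z → ⟦ X z ⊆? X x ⟧ * ω (X z))
      ≡⟨ χ-face x ⟩
    1ℚ ∎
    where
    open ≡-Reasoning
    c : Fin (size G) → ℚ
    c y = ⟦ intersects? (X x) (X y) ⟧
    rearrange : ∀ a b d e → a * b * (d * e) ≡ a * d * b * e
    rearrange = solve 4 (λ a b d e → a :* b :* (d :* e) := a :* d :* b :* e) refl

  Σ-signedStar : Σℚ signedStar ≡ χ G
  Σ-signedStar = begin
    Σℚ (λ x → ω (X x) * Σℚ (λ z → ⟦ X x ⊆? X z ⟧ * ω (X z)))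
      ≡⟨ Σℚ-*-Σℚ (ω ∘ X) (λ x z → ⟦ X x ⊆? X z ⟧ * ω (X z)) ⟩
    Σℚ (λ z → Σℚ (λ x → ω (X x) * (⟦ X x ⊆? X z ⟧ * ω (X z))))
      ≡⟨ Σℚ-cong (λ z → trans (Σℚ-cong (λ x → rearrange (ω (X x)) ⟦ X x ⊆? X z ⟧ (ω (X z))))
                              (Σℚ-*ʳ (ω (X z)) (λ x → ⟦ X x ⊆? X z ⟧ * ω (X x)))) ⟩
    Σℚ (λ z → Σℚ (λ x → ⟦ X x ⊆? X z ⟧ * ω (X x)) * ω (X z))
      ≡⟨ Σℚ-cong (λ z → cong (_* ω (X z)) (χ-face z)) ⟩
    Σℚ (λ z → 1ℚ * ω (X z))
      ≡⟨ Σℚ-cong (λ z → *-identityˡ (ω (X z))) ⟩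
    χ G ∎
    where
    open ≡-Reasoning
    rearrange : ∀ a b d → a * (b * d) ≡ b * a * d
    rearrange = solve 3 (λ a b d → a :* (b :* d) := b :* a :* d) refl

corollary2 : (n : ℕ) (G : SimplicialComplex n) (g : Matrix (size G)) →
    IsInverse (identity +ᴹ connAdj G) g →
    Σℚ (λ x → Σℚ (λ y → g x y)) ≡ χ G
corollary2 n G g (_ , g[1+A′]≡1) = begin
  Σℚ (λ x → Σℚ (g x))  ≡⟨ Σℚ-cong (row-sum-of-left-inverse (identity +ᴹ connAdj G) g (signedStar G)
                                     g[1+A′]≡1 (connection-·-signedStar G)) ⟩
  Σℚ (signedStar G)    ≡⟨ Σ-signedStar G ⟩
  χ G                  ∎
  where open ≡-Reasoning
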